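{- Let $\mathcal{B}=[0,1]^2$ and let $\mathbb{P}$ be the lateral nightrider, the two-move rider with moves $(2,1)$ and $(2,-1)$. Then the denominator of $(\mathcal{B}^q,\mathcal{A}_{\mathbb{P}}^q)$ is $1$ if $q=1$, $2$ if $q=2$, and $4$ if $q\ge3$.
   Context: For $\mathbf{z}=(\mathbf{z}_1,\dots,\mathbf{z}_q)\in\mathbb{R}^{2q}$, $\mathbf{z}_i=(x_i,y_i)$, and moves $\mathbf{m}_r=(c_r,d_r)$, attack equations are the hyperplanes $(\mathbf{z}_i-\mathbf{z}_j)\cdot(d_r,-c_r)=0$ ($i\ne j$), forming $\mathcal{A}_{\mathbb{P}}^q$; fixations are the hyperplanes $x_i=0,x_i=1,y_i=0,y_i=1$. A vertex of $(\mathcal{B}^q,\mathcal{A}_{\mathbb{P}}^q)$ is a point of $[0,1]^{2q}$ that is the unique common point of some collection of attack equations and fixations. The denominator of a rational point is the lcm of the denominators of its coordinates; the denominator of the inside-out polytope is the lcm over its vertices. -}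

module Defs where

open import Data.Nat using (ℕ)
open import Data.Nat.Divisibility using (_∣_)
open import Data.Nat.LCM using (lcm)
open import Data.Integer using (ℤ; +_; -[1+_])
open import Data.Rational using (ℚ; _/_; _-_; _*_; _≤_; 0ℚ; 1ℚ; ↧ₙ_)
open import Data.Fin using (Fin)
open import Data.Product using (_×_; _,_; proj₁; proj₂; ∃)
open import Data.List using (List; []; _∷_)
open import Data.List.Relation.Unary.All using (All)
open import Data.List.Membership.Propositional using (_∈_)
open import Data.Vec.Functional using (foldr)
open import Relation.Binary.PropositionalEquality using (_≡_; _≢_)

Move : Set
Move = ℤ × ℤ

Point : ℕ → Set
Point q = Fin q → ℚ × ℚ

xc : ∀ {q} → Point q → Fin q → ℚ
xc z i = proj₁ (z i)

yc : ∀ {q} → Point q → Fin q → ℚ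
yc z i = proj₂ (z i)

int : ℤ → ℚ
int n = n / 1

data Bit : Set where
  b0 b1 : Bit

bitℚ : Bit → ℚ
bitℚ b0 = 0ℚ
bitℚ b1 = 1ℚ

data Hyp (P : List Move) (q : ℕ) : Set where
  attack : (i j : Fin q) → i ≢ j → (m : Move) → m ∈ P → Hyp P q
  fixX   : Fin q → Bit → Hyp P q
  fixY   : Fin q → Bit → Hyp P q

OnHyp : ∀ {P q} → Hyp P q → Point q → Set
OnHyp (attack i j _ (c , d) _) z =
  ((xc z i - xc z j) * int d) - ((yc z i - yc z j) * int c) ≡ 0ℚ
OnHyp (fixX i b) z = xc z i ≡ bitℚ b
OnHyp (fixY i b) z = yc z i ≡ bitℚ b

InCube : ∀ {q} → Point q → Set
InCube {q} z = (i : Fin q) →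
  (0ℚ ≤ xc z i × xc z i ≤ 1ℚ) × (0ℚ ≤ yc z i × yc z i ≤ 1ℚ)

-- z is a vertex of (B^q, A_P^q): a point of [0,1]^{2q} which is the unique common
-- point (in the whole space) of some collection of attack equations and fixations.
IsVertex : (P : List Move) (q : ℕ) → Point q → Set
IsVertex P q z =
  InCube z ×
  ∃ λ (H : List (Hyp P q)) →
    All (λ h → OnHyp h z) H ×
    ((w : Point q) → All (λ h → OnHyp h w) H → (i : Fin q) → w i ≡ z i)

pointDen : ∀ {q} → Point q → ℕ
pointDen z = foldr (λ xy acc → lcm (lcm (↧ₙ proj₁ xy) (↧ₙ proj₂ xy)) acc) 1 z

IsDenominator : (P : List Move) (q : ℕ) → ℕ → Set
IsDenominator P q D =
  ((z : Point q) → IsVertex P q z → pointDen z ∣ D) ×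
  ((m : ℕ) → ((z : Point q) → IsVertex P q z → pointDen z ∣ m) → D ∣ m)

lateralNightrider : List Move
lateralNightrider = (+ 2 , + 1) ∷ (+ 2 , -[1+ 0 ]) ∷ []

module Submission where

-- In the coordinates U = x − 2y and V = x + 2y the attack equations of the two moves say
-- U_i = U_j and V_i = V_j, and the fixations say U + V ∈ {0, 2} and V − U ∈ {0, 4}. Moving
-- every point of the square by U ↦ U + snap U, V ↦ V + snap V, where snap is 0 on integers and
-- (−1)^⌊·⌋ elsewhere, keeps it on every hyperplane it lay on: the attacks because the move of U
-- depends on U alone (and likewise for V), the fixations because snap is odd about 0 and 1 and
-- takes the same value at x − 2 and x + 2. A vertex is the only point of its hyperplanes, so it is
-- fixed by this move: all its U and V are integers, and x = (U + V)/2, y = (V − U)/4 have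
-- denominators dividing 2 and 4. When q ≤ 2, a point off the boundary could be moved, together
-- with the points coinciding with it, in a direction in which no other point attacks it; so for
-- q = 1 both coordinates are 0 or 1 and for q = 2 one of them is, which lowers the bound to 1
-- and 2. The vertices ((0,0),(1,½)) and ((0,0),(1,0),(½,¼),(0,0),…) attain 2 and 4.

open import Defs
open import Algebra.Properties.Group using (identityʳ-unique; x∙y⁻¹≈ε⇒x≈y; x≈y⇒x∙y⁻¹≈ε)
open import Data.Bool using (Bool; true; false; if_then_else_; T)
open import Data.Empty using (⊥-elim)
open import Data.Fin using (Fin; zero; suc)
open import Data.Integer as ℤ using (ℤ; +_; -[1+_])
import Data.Integer.Properties as ℤ
open import Data.List using (List; []; _∷_; map; allFin)
open import Data.List.Relation.Unary.All using (All; []; _∷_)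
import Data.List.Relation.Unary.All as All
import Data.List.Relation.Unary.All.Properties as All
open import Data.List.Relation.Unary.Any using (here; there)
open import Data.List.Membership.Propositional.Properties using (∈-allFin)
open import Data.Nat as ℕ using (ℕ; zero; suc)
open import Data.Nat.Divisibility using (_∣_; divides; ∣-trans; ∣1⇒≡1; 1∣_; m∣m*n)
open import Data.Nat.LCM using (lcm; lcm-least; m∣lcm[m,n]; n∣lcm[m,n])
import Data.Nat.Properties as ℕ
open import Data.Product using (_×_; _,_; proj₁; proj₂; ∃-syntax)
open import Data.Product.Properties using (≡-dec)
open import Data.Rational using (ℚ; mkℚ; _/_; _+_; _-_; _*_; -_; -½; _≤_; _<_; _≤ᵇ_; _≤?_; 0ℚ; 1ℚ; ½; ↧_; ↧ₙ_; *<*)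
open import Data.Rational.Literals using (fromℤ)
open import Data.Rational.Properties
open import Data.Rational.Solver using (module +-*-Solver)
open import Data.Sum using (_⊎_; inj₁; inj₂)
open import Function using (_∘_)
open import Function.Bundles using (_⇔_; mk⇔; Equivalence)
open import Relation.Binary.Definitions using (tri<; tri≈; tri>)
open import Relation.Binary.PropositionalEquality
open import Relation.Nullary using (Dec; yes; no; ¬_)
open import Relation.Nullary.Decidable using (True; toWitness; decidable-stable; _⊎-dec_)

open +-*-Solver

-2ℚ -1ℚ 2ℚ 3ℚ : ℚ
-2ℚ = fromℤ -[1+ 1 ]
-1ℚ = fromℤ -[1+ 0 ]
2ℚ = fromℤ (+ 2)
3ℚ = fromℤ (+ 3)

¼ : ℚ
¼ = + 1 / 4

cancel-+ʳ : ∀ {a c} → a + c ≡ a → c ≡ 0ℚ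
cancel-+ʳ {a} {c} = identityʳ-unique +-0-group a c

≤-byEval : ∀ {p r : ℚ} {t : True (p ≤? r)} → p ≤ r
≤-byEval {t = t} = toWitness t

>⇒≤ᵇ≡false : ∀ {a l} → l < a → (a ≤ᵇ l) ≡ false
>⇒≤ᵇ≡false {a} {l} l<a with a ≤ᵇ l in eq
... | false = refl
... | true = ⊥-elim (<-irrefl refl (<-≤-trans l<a (≤ᵇ⇒≤ (subst T (sym eq) _))))

<⇒≤ᵇ≡true : ∀ {a h} → a < h → (a ≤ᵇ h) ≡ true
<⇒≤ᵇ≡true {a} {h} a<h with a ≤ᵇ h | ≤⇒≤ᵇ (<⇒≤ a<h)
... | true | _ = refl

abs-∣ : ∀ {a c b : ℤ} → a ℤ.* c ≡ b → ℤ.∣ a ∣ ∣ ℤ.∣ b ∣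
abs-∣ {a} {c} refl = subst (ℤ.∣ a ∣ ∣_) (sym (ℤ.abs-* a c)) (m∣m*n ℤ.∣ c ∣)

↧ₙ-+-∣ : ∀ p r → ↧ₙ (p + r) ∣ ↧ₙ p ℕ.* ↧ₙ r
↧ₙ-+-∣ p r = subst (↧ₙ (p + r) ∣_) (ℤ.abs-* (↧ p) (↧ r)) (abs-∣ {↧ (p + r)} (↧-+ p r))

↧ₙ-*-∣ : ∀ p r → ↧ₙ (p * r) ∣ ↧ₙ p ℕ.* ↧ₙ r
↧ₙ-*-∣ p r = subst (↧ₙ (p * r) ∣_) (ℤ.abs-* (↧ p) (↧ r)) (abs-∣ {↧ (p * r)} (↧-* p r))

Integral : ℚ → Set
Integral a = ↧ₙ a ≡ 1

Integral-+ : ∀ {a b} → Integral a → Integral b → Integral (a + b)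
Integral-+ {a} {b} ia ib = ∣1⇒≡1 (subst (↧ₙ (a + b) ∣_) (cong₂ ℕ._*_ ia ib) (↧ₙ-+-∣ a b))

Integral-neg : ∀ {a} → Integral a → Integral (- a)
Integral-neg {a} ia = trans (cong ℤ.∣_∣ (↧-neg a)) ia

Integral-- : ∀ {a b} → Integral a → Integral b → Integral (a - b)
Integral-- {a} {b} ia ib = Integral-+ {a} { - b} ia (Integral-neg {b} ib)

↧ₙ-*-Integral : ∀ r {a} → Integral a → ↧ₙ (r * a) ∣ ↧ₙ r
↧ₙ-*-Integral r {a} ia = subst (↧ₙ (r * a) ∣_) (trans (cong (↧ₙ r ℕ.*_) ia) (ℕ.*-identityʳ _)) (↧ₙ-*-∣ r a)

isIntegral : ℚ → Bool
isIntegral (mkℚ _ zero _) = true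
isIntegral (mkℚ _ (suc _) _) = false

isIntegral⇒Integral : ∀ {a} → isIntegral a ≡ true → Integral a
isIntegral⇒Integral {mkℚ _ zero _} _ = refl

between-integers⇒¬isIntegral : ∀ k {a} → fromℤ k < a → a < fromℤ (ℤ.suc k) → isIntegral a ≡ false
between-integers⇒¬isIntegral k {mkℚ _ (suc _) _} _ _ = refl
between-integers⇒¬isIntegral k {mkℚ n zero _} (*<* k<n) (*<* n<k+1)
  rewrite ℤ.*-identityʳ k | ℤ.*-identityʳ n | ℤ.*-identityʳ (ℤ.suc k) =
  ⊥-elim (ℤ.≤⇒≯ (ℤ.i<j⇒suc[i]≤j k<n) n<k+1)

pointDen-least : ∀ {q} (z : Point q) {m} → (∀ i → ↧ₙ (xc z i) ∣ m) → (∀ i → ↧ₙ (yc z i) ∣ m) → pointDen z ∣ m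
pointDen-least {zero} z {m} _ _ = 1∣ m
pointDen-least {suc q} z x∣m y∣m =
  lcm-least (lcm-least (x∣m zero) (y∣m zero)) (pointDen-least (z ∘ suc) (x∣m ∘ suc) (y∣m ∘ suc))

↧ₙ-yc∣pointDen : ∀ {q} (z : Point q) i → ↧ₙ (yc z i) ∣ pointDen z
↧ₙ-yc∣pointDen z zero =
  ∣-trans (n∣lcm[m,n] (↧ₙ xc z zero) (↧ₙ yc z zero)) (m∣lcm[m,n] _ (pointDen (z ∘ suc)))
↧ₙ-yc∣pointDen z (suc i) =
  ∣-trans (↧ₙ-yc∣pointDen (z ∘ suc) i) (n∣lcm[m,n] (lcm (↧ₙ xc z zero) (↧ₙ yc z zero)) _)

alternatingSign : ℚ → ℚ
alternatingSign a =
  if a ≤ᵇ -1ℚ then 1ℚ else if a ≤ᵇ 0ℚ then -1ℚ else if a ≤ᵇ 1ℚ then 1ℚ else if a ≤ᵇ 2ℚ then -1ℚ else 1ℚ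

-- snap a = (−1)^⌊a⌋ for non-integral a ∈ (−2, 3), an interval containing U and V of every point
-- of the square.
snap : ℚ → ℚ
snap a = if isIntegral a then 0ℚ else alternatingSign a

snap≡0⇒isIntegral : ∀ a → snap a ≡ 0ℚ → isIntegral a ≡ true
snap≡0⇒isIntegral a snap≡0 with isIntegral a
... | true = refl
... | false with a ≤ᵇ -1ℚ | a ≤ᵇ 0ℚ | a ≤ᵇ 1ℚ | a ≤ᵇ 2ℚ | snap≡0
... | true  | _     | _     | _     | ()
... | false | true  | _     | _     | ()
... | false | false | true  | _     | ()
... | false | false | false | true  | ()
... | false | false | false | false | ()

snap⟨-2,-1⟩ : ∀ {a} → -2ℚ < a → a < -1ℚ → snap a ≡ 1ℚ
snap⟨-2,-1⟩ l<a a<h rewrite between-integers⇒¬isIntegral -[1+ 1 ] l<a a<h | <⇒≤ᵇ≡true a<h = refl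

snap⟨-1,0⟩ : ∀ {a} → -1ℚ < a → a < 0ℚ → snap a ≡ -1ℚ
snap⟨-1,0⟩ l<a a<h rewrite between-integers⇒¬isIntegral -[1+ 0 ] l<a a<h
  | >⇒≤ᵇ≡false l<a | <⇒≤ᵇ≡true a<h = refl

snap⟨0,1⟩ : ∀ {a} → 0ℚ < a → a < 1ℚ → snap a ≡ 1ℚ
snap⟨0,1⟩ l<a a<h rewrite between-integers⇒¬isIntegral (+ 0) l<a a<h
  | >⇒≤ᵇ≡false (≤-<-trans (≤-byEval { -1ℚ} {0ℚ}) l<a) | >⇒≤ᵇ≡false l<a | <⇒≤ᵇ≡true a<h = refl

snap⟨1,2⟩ : ∀ {a} → 1ℚ < a → a < 2ℚ → snap a ≡ -1ℚ
snap⟨1,2⟩ l<a a<h rewrite between-integers⇒¬isIntegral (+ 1) l<a a<h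
  | >⇒≤ᵇ≡false (≤-<-trans (≤-byEval { -1ℚ} {1ℚ}) l<a) | >⇒≤ᵇ≡false (≤-<-trans (≤-byEval {0ℚ} {1ℚ}) l<a)
  | >⇒≤ᵇ≡false l<a | <⇒≤ᵇ≡true a<h = refl

snap⟨2,3⟩ : ∀ {a} → 2ℚ < a → a < 3ℚ → snap a ≡ 1ℚ
snap⟨2,3⟩ l<a a<h rewrite between-integers⇒¬isIntegral (+ 2) l<a a<h
  | >⇒≤ᵇ≡false (≤-<-trans (≤-byEval { -1ℚ} {2ℚ}) l<a) | >⇒≤ᵇ≡false (≤-<-trans (≤-byEval {0ℚ} {2ℚ}) l<a)
  | >⇒≤ᵇ≡false (≤-<-trans (≤-byEval {1ℚ} {2ℚ}) l<a) | >⇒≤ᵇ≡false l<a = refl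

≤⇒≡⊎< : ∀ {p r} → p ≤ r → p ≡ r ⊎ p < r
≤⇒≡⊎< {p} {r} p≤r with <-cmp p r
... | tri< p<r _ _ = inj₂ p<r
... | tri≈ _ p≡r _ = inj₁ p≡r
... | tri> _ _ p>r = ⊥-elim (<-irrefl refl (<-≤-trans p>r p≤r))

data Position[0,1] (x : ℚ) : Set where
  at0  : x ≡ 0ℚ → Position[0,1] x
  in01 : 0ℚ < x → x < 1ℚ → Position[0,1] x
  at1  : x ≡ 1ℚ → Position[0,1] x

position[0,1] : ∀ {x} → 0ℚ ≤ x → x ≤ 1ℚ → Position[0,1] x
position[0,1] 0≤x x≤1 with ≤⇒≡⊎< 0≤x | ≤⇒≡⊎< x≤1
... | inj₁ 0≡x | _        = at0 (sym 0≡x)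
... | inj₂ _   | inj₁ x≡1 = at1 x≡1
... | inj₂ 0<x | inj₂ x<1 = in01 0<x x<1

data Position[0,2] (x : ℚ) : Set where
  at0  : x ≡ 0ℚ → Position[0,2] x
  in01 : 0ℚ < x → x < 1ℚ → Position[0,2] x
  at1  : x ≡ 1ℚ → Position[0,2] x
  in12 : 1ℚ < x → x < 2ℚ → Position[0,2] x
  at2  : x ≡ 2ℚ → Position[0,2] x

position[0,2] : ∀ {x} → 0ℚ ≤ x → x ≤ 2ℚ → Position[0,2] x
position[0,2] {x} 0≤x x≤2 with <-cmp x 1ℚ | ≤⇒≡⊎< 0≤x | ≤⇒≡⊎< x≤2
... | tri≈ _ x≡1 _ | _        | _        = at1 x≡1
... | tri< _ _ _   | inj₁ 0≡x | _        = at0 (sym 0≡x)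
... | tri< x<1 _ _ | inj₂ 0<x | _        = in01 0<x x<1
... | tri> _ _ _   | _        | inj₁ x≡2 = at2 x≡2
... | tri> _ _ x>1 | _        | inj₂ x<2 = in12 x>1 x<2

snap[c-b]+snap[c+b]≡0 : ∀ c b → 0ℚ ≤ b → b ≤ 2ℚ → snap (bitℚ c - b) + snap (bitℚ c + b) ≡ 0ℚ
snap[c-b]+snap[c+b]≡0 b0 b 0≤b b≤2 rewrite +-identityˡ (- b) | +-identityˡ b with position[0,2] 0≤b b≤2
... | at0 refl = refl
... | at1 refl = refl
... | at2 refl = refl
... | in01 0<b b<1 rewrite snap⟨-1,0⟩ (neg-antimono-< b<1) (neg-antimono-< 0<b) | snap⟨0,1⟩ 0<b b<1 = refl
... | in12 1<b b<2 rewrite snap⟨-2,-1⟩ (neg-antimono-< b<2) (neg-antimono-< 1<b) | snap⟨1,2⟩ 1<b b<2 = refl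
snap[c-b]+snap[c+b]≡0 b1 b 0≤b b≤2 with position[0,2] 0≤b b≤2
... | at0 refl = refl
... | at1 refl = refl
... | at2 refl = refl
... | in01 0<b b<1
  rewrite snap⟨0,1⟩ (+-monoʳ-< 1ℚ (neg-antimono-< b<1)) (+-monoʳ-< 1ℚ (neg-antimono-< 0<b))
        | snap⟨1,2⟩ (+-monoʳ-< 1ℚ 0<b) (+-monoʳ-< 1ℚ b<1) = refl
... | in12 1<b b<2
  rewrite snap⟨-1,0⟩ (+-monoʳ-< 1ℚ (neg-antimono-< b<2)) (+-monoʳ-< 1ℚ (neg-antimono-< 1<b))
        | snap⟨2,3⟩ (+-monoʳ-< 1ℚ 1<b) (+-monoʳ-< 1ℚ b<2) = refl

snap[x+2]≡snap[x-2] : ∀ x → 0ℚ ≤ x → x ≤ 1ℚ → snap (x + 2ℚ) ≡ snap (x - 2ℚ)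
snap[x+2]≡snap[x-2] x 0≤x x≤1 with position[0,1] 0≤x x≤1
... | at0 refl = refl
... | at1 refl = refl
... | in01 0<x x<1
  rewrite snap⟨2,3⟩ (+-monoˡ-< 2ℚ 0<x) (+-monoˡ-< 2ℚ x<1)
        | snap⟨-2,-1⟩ (+-monoˡ-< (- 2ℚ) 0<x) (+-monoˡ-< (- 2ℚ) x<1) = refl

U V : ℚ × ℚ → ℚ
U (x , y) = x - (y + y)
V (x , y) = x + (y + y)

fromUV : ℚ → ℚ → ℚ × ℚ
fromUV u v = ½ * (u + v) , ¼ * (v - u)

U-fromUV : ∀ u v → U (fromUV u v) ≡ u
U-fromUV = solve 2 (λ u v → con ½ :* (u :+ v) :- (con ¼ :* (v :- u) :+ con ¼ :* (v :- u)) := u) refl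

V-fromUV : ∀ u v → V (fromUV u v) ≡ v
V-fromUV = solve 2 (λ u v → con ½ :* (u :+ v) :+ (con ¼ :* (v :- u) :+ con ¼ :* (v :- u)) := v) refl

fromUV-UV : ∀ p → fromUV (U p) (V p) ≡ p
fromUV-UV (x , y) = cong₂ _,_
  (solve 2 (λ x y → con ½ :* ((x :- (y :+ y)) :+ (x :+ (y :+ y))) := x) refl x y)
  (solve 2 (λ x y → con ¼ :* ((x :+ (y :+ y)) :- (x :- (y :+ y))) := y) refl x y)

_⊕_ : ℚ × ℚ → ℚ × ℚ → ℚ × ℚ
(x , y) ⊕ (dx , dy) = x + dx , y + dy

U-⊕ : ∀ p d → U (p ⊕ d) ≡ U p + U d
U-⊕ (x , y) (dx , dy) =
  solve 4 (λ x y dx dy → (x :+ dx) :- ((y :+ dy) :+ (y :+ dy)) := (x :- (y :+ y)) :+ (dx :- (dy :+ dy))) refl x y dx dy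

V-⊕ : ∀ p d → V (p ⊕ d) ≡ V p + V d
V-⊕ (x , y) (dx , dy) =
  solve 4 (λ x y dx dy → (x :+ dx) :+ ((y :+ dy) :+ (y :+ dy)) := (x :+ (y :+ y)) :+ (dx :+ (dy :+ dy))) refl x y dx dy

UV-determine : ∀ {p u v} → U p ≡ u → V p ≡ v → p ≡ fromUV u v
UV-determine {p} Up≡u Vp≡v = trans (sym (fromUV-UV p)) (cong₂ fromUV Up≡u Vp≡v)

y≡½[x-U] : ∀ p → proj₂ p ≡ ½ * (proj₁ p - U p)
y≡½[x-U] (x , y) = solve 2 (λ x y → y := con ½ :* (x :- (x :- (y :+ y)))) refl x y

⊕-cancel : ∀ p d → p ⊕ d ≡ p → d ≡ (0ℚ , 0ℚ)
⊕-cancel (x , y) (dx , dy) p⊕d≡p = cong₂ _,_ (cancel-+ʳ (cong proj₁ p⊕d≡p)) (cancel-+ʳ (cong proj₂ p⊕d≡p))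

attack[2,1]≡U-U : ∀ p r → ((proj₁ p - proj₁ r) * int (+ 1)) - ((proj₂ p - proj₂ r) * int (+ 2)) ≡ U p - U r
attack[2,1]≡U-U (x , y) (x′ , y′) =
  solve 4 (λ x y x′ y′ → ((x :- x′) :* con 1ℚ) :- ((y :- y′) :* con 2ℚ) := (x :- (y :+ y)) :- (x′ :- (y′ :+ y′)))
    refl x y x′ y′

attack[2,-1]≡V-V : ∀ p r → ((proj₁ p - proj₁ r) * int -[1+ 0 ]) - ((proj₂ p - proj₂ r) * int (+ 2)) ≡ V r - V p
attack[2,-1]≡V-V (x , y) (x′ , y′) =
  solve 4 (λ x y x′ y′ → ((x :- x′) :* con -1ℚ) :- ((y :- y′) :* con 2ℚ) := (x′ :+ (y′ :+ y′)) :- (x :+ (y :+ y)))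
    refl x y x′ y′

-≡0⇔≡ : ∀ {a b e} → e ≡ a - b → e ≡ 0ℚ ⇔ a ≡ b
-≡0⇔≡ {a} {b} refl = mk⇔ (x∙y⁻¹≈ε⇒x≈y +-0-group a b) (x≈y⇒x∙y⁻¹≈ε +-0-group)

onAttack[2,1]⇔ : ∀ p r → ((proj₁ p - proj₁ r) * int (+ 1)) - ((proj₂ p - proj₂ r) * int (+ 2)) ≡ 0ℚ ⇔ U p ≡ U r
onAttack[2,1]⇔ p r = -≡0⇔≡ (attack[2,1]≡U-U p r)

onAttack[2,-1]⇔ : ∀ p r → ((proj₁ p - proj₁ r) * int -[1+ 0 ]) - ((proj₂ p - proj₂ r) * int (+ 2)) ≡ 0ℚ ⇔ V r ≡ V p
onAttack[2,-1]⇔ p r = -≡0⇔≡ (attack[2,-1]≡V-V p r)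

OnHypsOf : (P : List Move) {q : ℕ} → Point q → Point q → Set
OnHypsOf P {q} z w = (h : Hyp P q) → OnHyp h z → OnHyp h w

vertex-rigid : ∀ {P q} {z : Point q} → IsVertex P q z → (w : Point q) → OnHypsOf P z w → ∀ i → w i ≡ z i
vertex-rigid (_ , H , onH , unique) w z⇒w = unique w (All.map (z⇒w _) onH)

onHypsOf-intro : ∀ {q} {z w : Point q}
  → (∀ i j → U (z i) ≡ U (z j) → U (w i) ≡ U (w j))
  → (∀ i j → V (z i) ≡ V (z j) → V (w i) ≡ V (w j))
  → (∀ i c → proj₁ (z i) ≡ bitℚ c → proj₁ (w i) ≡ bitℚ c)
  → (∀ i c → proj₂ (z i) ≡ bitℚ c → proj₂ (w i) ≡ bitℚ c)
  → OnHypsOf lateralNightrider z w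
onHypsOf-intro {z = z} {w} U-pres _ _ _ (attack i j _ _ (here refl)) =
  Equivalence.from (onAttack[2,1]⇔ (w i) (w j)) ∘ U-pres i j ∘ Equivalence.to (onAttack[2,1]⇔ (z i) (z j))
onHypsOf-intro {z = z} {w} _ V-pres _ _ (attack i j _ _ (there (here refl))) =
  Equivalence.from (onAttack[2,-1]⇔ (w i) (w j)) ∘ V-pres j i ∘ Equivalence.to (onAttack[2,-1]⇔ (z i) (z j))
onHypsOf-intro _ _ x-pres _ (fixX i c) = x-pres i c
onHypsOf-intro _ _ _ y-pres (fixY i c) = y-pres i c

snapPoint : ℚ × ℚ → ℚ × ℚ
snapPoint p = p ⊕ fromUV (snap (U p)) (snap (V p))

U-snapPoint : ∀ p → U (snapPoint p) ≡ U p + snap (U p)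
U-snapPoint p = trans (U-⊕ p (fromUV (snap (U p)) (snap (V p))))
                      (cong (λ s → U p + s) (U-fromUV (snap (U p)) (snap (V p))))

V-snapPoint : ∀ p → V (snapPoint p) ≡ V p + snap (V p)
V-snapPoint p = trans (V-⊕ p (fromUV (snap (U p)) (snap (V p))))
                      (cong (λ s → V p + s) (V-fromUV (snap (U p)) (snap (V p))))

snapPoint-preserves-x : ∀ p c → proj₁ p ≡ bitℚ c → 0ℚ ≤ proj₂ p → proj₂ p ≤ 1ℚ → proj₁ (snapPoint p) ≡ bitℚ c
snapPoint-preserves-x (x , y) c refl 0≤y y≤1
  rewrite snap[c-b]+snap[c+b]≡0 c (y + y) (+-mono-≤ 0≤y 0≤y) (+-mono-≤ y≤1 y≤1) = +-identityʳ (bitℚ c)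

snapPoint-preserves-y : ∀ p c → proj₂ p ≡ bitℚ c → 0ℚ ≤ proj₁ p → proj₁ p ≤ 1ℚ → proj₂ (snapPoint p) ≡ bitℚ c
-- With y = 0 both U and V reduce to x + 0ℚ.
snapPoint-preserves-y (x , y) b0 refl _ _ rewrite +-inverseʳ (snap (x + 0ℚ)) = refl
snapPoint-preserves-y (x , y) b1 refl 0≤x x≤1
  rewrite snap[x+2]≡snap[x-2] x 0≤x x≤1 | +-inverseʳ (snap (x - 2ℚ)) = refl

vertex-snapPoint : ∀ {q} {z : Point q} → IsVertex lateralNightrider q z → ∀ i → snapPoint (z i) ≡ z i
vertex-snapPoint {z = z} vz = vertex-rigid vz (snapPoint ∘ z) (onHypsOf-intro U-pres V-pres x-pres y-pres)
  where
  U-pres : ∀ i j → U (z i) ≡ U (z j) → U (snapPoint (z i)) ≡ U (snapPoint (z j))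
  U-pres i j e = trans (U-snapPoint (z i)) (trans (cong (λ u → u + snap u) e) (sym (U-snapPoint (z j))))
  V-pres : ∀ i j → V (z i) ≡ V (z j) → V (snapPoint (z i)) ≡ V (snapPoint (z j))
  V-pres i j e = trans (V-snapPoint (z i)) (trans (cong (λ v → v + snap v) e) (sym (V-snapPoint (z j))))
  x-pres : ∀ i c → proj₁ (z i) ≡ bitℚ c → proj₁ (snapPoint (z i)) ≡ bitℚ c
  x-pres i c e = let (_ , (0≤y , y≤1)) = proj₁ vz i in snapPoint-preserves-x (z i) c e 0≤y y≤1
  y-pres : ∀ i c → proj₂ (z i) ≡ bitℚ c → proj₂ (snapPoint (z i)) ≡ bitℚ c
  y-pres i c e = let ((0≤x , x≤1) , _) = proj₁ vz i in snapPoint-preserves-y (z i) c e 0≤x x≤1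

IntegralUV : ℚ × ℚ → Set
IntegralUV p = Integral (U p) × Integral (V p)

snapPoint-fixed⇒IntegralUV : ∀ p → snapPoint p ≡ p → IntegralUV p
snapPoint-fixed⇒IntegralUV p fixed =
    integral {U p} (cancel-+ʳ (trans (sym (U-snapPoint p)) (cong U fixed)))
  , integral {V p} (cancel-+ʳ (trans (sym (V-snapPoint p)) (cong V fixed)))
  where
  integral : ∀ {a} → snap a ≡ 0ℚ → Integral a
  integral {a} = isIntegral⇒Integral ∘ snap≡0⇒isIntegral a

IntegralUV⇒↧ₙx∣2 : ∀ {p} → IntegralUV p → ↧ₙ (proj₁ p) ∣ 2
IntegralUV⇒↧ₙx∣2 {p} (iu , iv) =
  subst (λ r → ↧ₙ (proj₁ r) ∣ 2) (fromUV-UV p) (↧ₙ-*-Integral ½ {U p + V p} (Integral-+ {U p} {V p} iu iv))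

IntegralUV⇒↧ₙy∣4 : ∀ {p} → IntegralUV p → ↧ₙ (proj₂ p) ∣ 4
IntegralUV⇒↧ₙy∣4 {p} (iu , iv) =
  subst (λ r → ↧ₙ (proj₂ r) ∣ 4) (fromUV-UV p) (↧ₙ-*-Integral ¼ {V p - U p} (Integral-- {V p} {U p} iv iu))

vertex-IntegralUV : ∀ {q} {z : Point q} → IsVertex lateralNightrider q z → ∀ i → IntegralUV (z i)
vertex-IntegralUV {z = z} vz i = snapPoint-fixed⇒IntegralUV (z i) (vertex-snapPoint vz i)

vertex-pointDen∣4 : ∀ {q} (z : Point q) → IsVertex lateralNightrider q z → pointDen z ∣ 4
vertex-pointDen∣4 z vz = pointDen-least z
  (λ i → ∣-trans (IntegralUV⇒↧ₙx∣2 {z i} (vertex-IntegralUV vz i)) (divides 2 refl))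
  (λ i → IntegralUV⇒↧ₙy∣4 {z i} (vertex-IntegralUV vz i))

IsBit : ℚ → Set
IsBit a = ∃[ c ] a ≡ bitℚ c

_≟ₚ_ : (p r : ℚ × ℚ) → Dec (p ≡ r)
_≟ₚ_ = ≡-dec _≟_ _≟_

Additive : (ℚ × ℚ → ℚ) → Set
Additive F = ∀ p d → F (p ⊕ d) ≡ F p + F d

moveCluster : ∀ {q} → Point q → Fin q → ℚ × ℚ → Point q
moveCluster z i d k with z k ≟ₚ z i
... | yes _ = z k ⊕ d
... | no _  = z k

F⊕-null : ∀ {F} → Additive F → ∀ p {d} → F d ≡ 0ℚ → F (p ⊕ d) ≡ F p
F⊕-null {F} additive p {d} Fd≡0 = begin
  F (p ⊕ d)   ≡⟨ additive p d ⟩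
  F p + F d   ≡⟨ cong (λ s → F p + s) Fd≡0 ⟩
  F p + 0ℚ    ≡⟨ +-identityʳ (F p) ⟩
  F p         ∎
  where open ≡-Reasoning

module _ {q} (z : Point q) (i : Fin q) (d : ℚ × ℚ) where

  moveCluster-at : moveCluster z i d i ≡ z i ⊕ d
  moveCluster-at with z i ≟ₚ z i
  ... | yes _ = refl
  ... | no zi≢zi = ⊥-elim (zi≢zi refl)

  module _ {F : ℚ × ℚ → ℚ} (additive : Additive F) where

    moveCluster-preserves-value : ∀ {t} → (F (z i) ≡ t → F d ≡ 0ℚ) → ∀ k → F (z k) ≡ t → F (moveCluster z i d k) ≡ t
    moveCluster-preserves-value Fd≡0 k Fzk≡t with z k ≟ₚ z i
    ... | no _      = Fzk≡t
    ... | yes zk≡zi = trans (F⊕-null {F} additive (z k) (Fd≡0 (trans (cong F (sym zk≡zi)) Fzk≡t))) Fzk≡t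

    moveCluster-preserves-≡ : (∀ l → z l ≢ z i → F (z l) ≡ F (z i) → F d ≡ 0ℚ)
      → ∀ k l → F (z k) ≡ F (z l) → F (moveCluster z i d k) ≡ F (moveCluster z i d l)
    moveCluster-preserves-≡ Fd≡0 k l e with z k ≟ₚ z i | z l ≟ₚ z i
    ... | yes _     | yes _     = trans (additive (z k) d) (trans (cong (λ s → s + F d) e) (sym (additive (z l) d)))
    ... | yes zk≡zi | no zl≢zi  = trans (F⊕-null {F} additive (z k) (Fd≡0 l zl≢zi (trans (sym e) (cong F zk≡zi)))) e
    ... | no zk≢zi  | yes zl≡zi = trans e (sym (F⊕-null {F} additive (z l) (Fd≡0 k zk≢zi (trans e (cong F zl≡zi)))))
    ... | no _      | no _      = e

vertex-cluster-rigid : ∀ {q} {z : Point q} → IsVertex lateralNightrider q z → ∀ i d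
  → (IsBit (proj₁ (z i)) → proj₁ d ≡ 0ℚ)
  → (IsBit (proj₂ (z i)) → proj₂ d ≡ 0ℚ)
  → (∀ l → z l ≢ z i → U (z l) ≡ U (z i) → U d ≡ 0ℚ)
  → (∀ l → z l ≢ z i → V (z l) ≡ V (z i) → V d ≡ 0ℚ)
  → d ≡ (0ℚ , 0ℚ)
vertex-cluster-rigid {z = z} vz i d x-free y-free U-free V-free =
  ⊕-cancel (z i) d (trans (sym (moveCluster-at z i d)) (vertex-rigid vz (moveCluster z i d) onHyps i))
  where
  onHyps : OnHypsOf lateralNightrider z (moveCluster z i d)
  onHyps = onHypsOf-intro
    (moveCluster-preserves-≡ z i d U-⊕ U-free)
    (moveCluster-preserves-≡ z i d V-⊕ V-free)
    (λ k c → moveCluster-preserves-value z i d {proj₁} (λ _ _ → refl) (λ e → x-free (c , e)) k)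
    (λ k c → moveCluster-preserves-value z i d {proj₂} (λ _ _ → refl) (λ e → y-free (c , e)) k)

isBit? : ∀ a → Dec (IsBit a)
isBit? a with a ≟ 0ℚ | a ≟ 1ℚ
... | yes a≡0 | _       = yes (b0 , a≡0)
... | no _    | yes a≡1 = yes (b1 , a≡1)
... | no a≢0  | no a≢1  = no λ { (b0 , a≡0) → a≢0 a≡0 ; (b1 , a≡1) → a≢1 a≡1 }

IsBit⇒Integral : ∀ {a} → IsBit a → Integral a
IsBit⇒Integral (b0 , refl) = refl
IsBit⇒Integral (b1 , refl) = refl

IsBit⇒↧ₙ∣ : ∀ n {a} → IsBit a → ↧ₙ a ∣ n
IsBit⇒↧ₙ∣ n (b0 , refl) = 1∣ n
IsBit⇒↧ₙ∣ n (b1 , refl) = 1∣ n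

vertex₁-coordinates-are-bits : ∀ {z : Point 1} → IsVertex lateralNightrider 1 z
  → IsBit (proj₁ (z zero)) × IsBit (proj₂ (z zero))
vertex₁-coordinates-are-bits {z} vz =
    decidable-stable (isBit? _) (λ ¬x-bit → 1≢0 (cong proj₁ (rigid (1ℚ , 0ℚ) (⊥-elim ∘ ¬x-bit) (λ _ → refl))))
  , decidable-stable (isBit? _) (λ ¬y-bit → 1≢0 (cong proj₂ (rigid (0ℚ , 1ℚ) (λ _ → refl) (⊥-elim ∘ ¬y-bit))))
  where
  alone : ∀ {A : Set} l → z l ≢ z zero → A
  alone zero zl≢z0 = ⊥-elim (zl≢z0 refl)
  rigid : ∀ d → (IsBit (proj₁ (z zero)) → proj₁ d ≡ 0ℚ) → (IsBit (proj₂ (z zero)) → proj₂ d ≡ 0ℚ) → d ≡ (0ℚ , 0ℚ)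
  rigid d x-free y-free = vertex-cluster-rigid vz zero d x-free y-free (λ l n → alone l n) (λ l n → alone l n)

vertex₁-pointDen∣1 : ∀ (z : Point 1) → IsVertex lateralNightrider 1 z → pointDen z ∣ 1
vertex₁-pointDen∣1 z vz = pointDen-least z
  (λ { zero → IsBit⇒↧ₙ∣ 1 {xc z zero} (proj₁ (vertex₁-coordinates-are-bits vz)) })
  (λ { zero → IsBit⇒↧ₙ∣ 1 {yc z zero} (proj₂ (vertex₁-coordinates-are-bits vz)) })

other : Fin 2 → Fin 2
other zero       = suc zero
other (suc zero) = zero

≢⇒≡other : ∀ {i l : Fin 2} → l ≢ i → l ≡ other i
≢⇒≡other {zero}     {zero}     l≢i = ⊥-elim (l≢i refl)
≢⇒≡other {zero}     {suc zero} _   = refl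
≢⇒≡other {suc zero} {zero}     _   = refl
≢⇒≡other {suc zero} {suc zero} l≢i = ⊥-elim (l≢i refl)

OnBoundary : ℚ × ℚ → Set
OnBoundary p = IsBit (proj₁ p) ⊎ IsBit (proj₂ p)

vertex₂-on-boundary : ∀ {z : Point 2} → IsVertex lateralNightrider 2 z → ∀ i → OnBoundary (z i)
vertex₂-on-boundary {z} vz i = decidable-stable (isBit? _ ⊎-dec isBit? _) interior-impossible
  where
  j = other i
  partner : ∀ l → z l ≢ z i → z l ≡ z j
  partner l zl≢zi = cong z (≢⇒≡other (zl≢zi ∘ cong z))
  rigid : ¬ OnBoundary (z i) → ∀ d
    → (∀ l → z l ≢ z i → U (z l) ≡ U (z i) → U d ≡ 0ℚ)
    → (∀ l → z l ≢ z i → V (z l) ≡ V (z i) → V d ≡ 0ℚ)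
    → d ≡ (0ℚ , 0ℚ)
  rigid interior d = vertex-cluster-rigid vz i d (⊥-elim ∘ interior ∘ inj₁) (⊥-elim ∘ interior ∘ inj₂)
  interior-impossible : ¬ ¬ OnBoundary (z i)
  -- (1 , -½) moves U only and (1 , ½) moves V only.
  interior-impossible interior with U (z j) ≟ U (z i) | V (z j) ≟ V (z i)
  ... | no Uj≢Ui | _ = 1≢0 (cong proj₁ (rigid interior (1ℚ , -½)
          (λ l zl≢zi Ul≡Ui → ⊥-elim (Uj≢Ui (trans (cong U (sym (partner l zl≢zi))) Ul≡Ui))) (λ _ _ _ → refl)))
  ... | yes _ | no Vj≢Vi = 1≢0 (cong proj₁ (rigid interior (1ℚ , ½)
          (λ _ _ _ → refl) (λ l zl≢zi Vl≡Vi → ⊥-elim (Vj≢Vi (trans (cong V (sym (partner l zl≢zi))) Vl≡Vi)))))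
  ... | yes Uj≡Ui | yes Vj≡Vi = 1≢0 (cong proj₁ (rigid interior (1ℚ , 0ℚ) (λ l → coincide l) (λ l → coincide l)))
    where
    zj≡zi : z j ≡ z i
    zj≡zi = trans (UV-determine Uj≡Ui Vj≡Vi) (fromUV-UV (z i))
    coincide : ∀ {A : Set} l → z l ≢ z i → A
    coincide l zl≢zi = ⊥-elim (zl≢zi (trans (partner l zl≢zi) zj≡zi))

boundary-IntegralUV⇒↧ₙ∣2 : ∀ {p} → IntegralUV p → OnBoundary p → ↧ₙ (proj₁ p) ∣ 2 × ↧ₙ (proj₂ p) ∣ 2
boundary-IntegralUV⇒↧ₙ∣2 {p} (iu , _) (inj₁ x-bit) =
    IsBit⇒↧ₙ∣ 2 {proj₁ p} x-bit
  , subst (λ y → ↧ₙ y ∣ 2) (sym (y≡½[x-U] p))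
      (↧ₙ-*-Integral ½ {proj₁ p - U p} (Integral-- {proj₁ p} {U p} (IsBit⇒Integral {proj₁ p} x-bit) iu))
boundary-IntegralUV⇒↧ₙ∣2 {p} iuv (inj₂ y-bit) = IntegralUV⇒↧ₙx∣2 {p} iuv , IsBit⇒↧ₙ∣ 2 {proj₂ p} y-bit

vertex₂-pointDen∣2 : ∀ (z : Point 2) → IsVertex lateralNightrider 2 z → pointDen z ∣ 2
vertex₂-pointDen∣2 z vz = pointDen-least z (proj₁ ∘ den∣2) (proj₂ ∘ den∣2)
  where
  den∣2 : ∀ i → ↧ₙ (xc z i) ∣ 2 × ↧ₙ (yc z i) ∣ 2
  den∣2 i = boundary-IntegralUV⇒↧ₙ∣2 {z i} (vertex-IntegralUV vz i) (vertex₂-on-boundary vz i)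

isDenominator-intro : ∀ {P q D} → (∀ z → IsVertex P q z → pointDen z ∣ D)
  → (w : Point q) → IsVertex P q w → D ∣ pointDen w → IsDenominator P q D
isDenominator-intro upper w vw D∣w = upper , λ m common → ∣-trans D∣w (common w vw)

z₂ : Point 2
z₂ zero       = 0ℚ , 0ℚ
z₂ (suc zero) = 1ℚ , ½

z₂-inCube : InCube z₂
z₂-inCube zero       = (≤-byEval , ≤-byEval) , (≤-byEval , ≤-byEval)
z₂-inCube (suc zero) = (≤-byEval , ≤-byEval) , (≤-byEval , ≤-byEval)

vertex-z₂ : IsVertex lateralNightrider 2 z₂
vertex-z₂ = z₂-inCube , hyps , (refl ∷ refl ∷ refl ∷ refl ∷ []) , unique
  where
  hyps : List (Hyp lateralNightrider 2)
  hyps = fixX zero b0 ∷ fixY zero b0 ∷ fixX (suc zero) b1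
       ∷ attack (suc zero) zero (λ ()) (+ 2 , + 1) (here refl) ∷ []
  unique : (w : Point 2) → All (λ h → OnHyp h w) hyps → ∀ i → w i ≡ z₂ i
  unique w (x₀ ∷ y₀ ∷ _ ∷ _ ∷ []) zero = cong₂ _,_ x₀ y₀
  unique w (x₀ ∷ y₀ ∷ x₁ ∷ attack₁₀ ∷ []) (suc zero) = cong₂ _,_ x₁ (begin
    proj₂ (w i₁)                  ≡⟨ y≡½[x-U] (w i₁) ⟩
    ½ * (proj₁ (w i₁) - U (w i₁)) ≡⟨ cong₂ (λ x u → ½ * (x - u)) x₁ U₁≡U₀ ⟩
    ½ * (1ℚ - U (w zero))         ≡⟨ cong (λ p → ½ * (1ℚ - U p)) (cong₂ _,_ x₀ y₀) ⟩
    ½                             ∎)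
    where
    open ≡-Reasoning
    i₁ = suc zero
    U₁≡U₀ : U (w i₁) ≡ U (w zero)
    U₁≡U₀ = Equivalence.to (onAttack[2,1]⇔ (w i₁) (w zero)) attack₁₀

pinAtOrigin : ∀ {P q} → List (Fin q) → List (Hyp P q)
pinAtOrigin []       = []
pinAtOrigin (i ∷ is) = fixX i b0 ∷ fixY i b0 ∷ pinAtOrigin is

All-pinAtOrigin⁺ : ∀ {P q} {w : Point q} is
  → All (λ i → w i ≡ (0ℚ , 0ℚ)) is → All (λ h → OnHyp h w) (pinAtOrigin {P} is)
All-pinAtOrigin⁺ []       []                 = []
All-pinAtOrigin⁺ (i ∷ is) (wi≡0 ∷ at-origin) = cong proj₁ wi≡0 ∷ cong proj₂ wi≡0 ∷ All-pinAtOrigin⁺ is at-origin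

All-pinAtOrigin⁻ : ∀ {P q} {w : Point q} is
  → All (λ h → OnHyp h w) (pinAtOrigin {P} is) → All (λ i → w i ≡ (0ℚ , 0ℚ)) is
All-pinAtOrigin⁻ []       []              = []
All-pinAtOrigin⁻ (i ∷ is) (x≡0 ∷ y≡0 ∷ on) = cong₂ _,_ x≡0 y≡0 ∷ All-pinAtOrigin⁻ is on

z₃ : ∀ k → Point (3 ℕ.+ k)
z₃ k zero                = 0ℚ , 0ℚ
z₃ k (suc zero)          = 1ℚ , 0ℚ
z₃ k (suc (suc zero))    = ½ , ¼
z₃ k (suc (suc (suc _))) = 0ℚ , 0ℚ

z₃-inCube : ∀ k → InCube (z₃ k)
z₃-inCube k zero                = (≤-byEval , ≤-byEval) , (≤-byEval , ≤-byEval)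
z₃-inCube k (suc zero)          = (≤-byEval , ≤-byEval) , (≤-byEval , ≤-byEval)
z₃-inCube k (suc (suc zero))    = (≤-byEval , ≤-byEval) , (≤-byEval , ≤-byEval)
z₃-inCube k (suc (suc (suc _))) = (≤-byEval , ≤-byEval) , (≤-byEval , ≤-byEval)

vertex-z₃ : ∀ k → IsVertex lateralNightrider (3 ℕ.+ k) (z₃ k)
vertex-z₃ k = z₃-inCube k , hyps , on-hyps , unique
  where
  extras : List (Fin (3 ℕ.+ k))
  extras = map (λ l → suc (suc (suc l))) (allFin k)
  hyps : List (Hyp lateralNightrider (3 ℕ.+ k))
  hyps = fixX zero b0 ∷ fixY zero b0 ∷ fixX (suc zero) b1 ∷ fixY (suc zero) b0
       ∷ attack (suc (suc zero)) zero (λ ()) (+ 2 , + 1) (here refl)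
       ∷ attack (suc (suc zero)) (suc zero) (λ ()) (+ 2 , -[1+ 0 ]) (there (here refl))
       ∷ pinAtOrigin extras
  on-hyps : All (λ h → OnHyp h (z₃ k)) hyps
  on-hyps = refl ∷ refl ∷ refl ∷ refl ∷ refl ∷ refl
          ∷ All-pinAtOrigin⁺ extras (All.map⁺ (All.universal (λ _ → refl) (allFin k)))
  unique : (w : Point (3 ℕ.+ k)) → All (λ h → OnHyp h w) hyps → ∀ i → w i ≡ z₃ k i
  unique w (x₀ ∷ y₀ ∷ _ ∷ _ ∷ _) zero = cong₂ _,_ x₀ y₀
  unique w (_ ∷ _ ∷ x₁ ∷ y₁ ∷ _) (suc zero) = cong₂ _,_ x₁ y₁
  unique w (x₀ ∷ y₀ ∷ x₁ ∷ y₁ ∷ attack₂₀ ∷ attack₂₁ ∷ _) (suc (suc zero)) =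
    UV-determine (trans U₂≡U₀ (cong U (cong₂ _,_ x₀ y₀))) (trans (sym V₁≡V₂) (cong V (cong₂ _,_ x₁ y₁)))
    where
    i₂ = suc (suc zero)
    U₂≡U₀ : U (w i₂) ≡ U (w zero)
    U₂≡U₀ = Equivalence.to (onAttack[2,1]⇔ (w i₂) (w zero)) attack₂₀
    V₁≡V₂ : V (w (suc zero)) ≡ V (w i₂)
    V₁≡V₂ = Equivalence.to (onAttack[2,-1]⇔ (w i₂) (w (suc zero))) attack₂₁
  unique w (_ ∷ _ ∷ _ ∷ _ ∷ _ ∷ _ ∷ pinned) (suc (suc (suc l))) =
    All.lookup (All.map⁻ (All-pinAtOrigin⁻ extras pinned)) (∈-allFin l)

corollary6p13 : IsDenominator lateralNightrider 1 1
    × IsDenominator lateralNightrider 2 2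
    × ((q : ℕ) → 3 ℕ.≤ q → IsDenominator lateralNightrider q 4)
corollary6p13 =
    (vertex₁-pointDen∣1 , λ m _ → 1∣ m)
  , isDenominator-intro vertex₂-pointDen∣2 z₂ vertex-z₂ (↧ₙ-yc∣pointDen z₂ (suc zero))
  , λ { (suc (suc (suc k))) (ℕ.s≤s (ℕ.s≤s (ℕ.s≤s _))) →
          isDenominator-intro vertex-pointDen∣4 (z₃ k) (vertex-z₃ k) (↧ₙ-yc∣pointDen (z₃ k) (suc (suc zero))) }
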